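{- Let $\alpha,\beta$ be compositions of a positive integer $n$. If $\mathrm{THC}_{\alpha,\beta}\neq\emptyset$, then $\alpha\trianglerighteq\beta$, and hence $\alpha\geq_\ell\beta$. Moreover, $\mathrm{THC}_{\alpha,\alpha}$ consists of a single element $T$, and $\operatorname{perm}(T)$ is the identity permutation of $S_{\ell(\alpha)}$.
   Context: A composition of $n$ is a finite sequence of positive integers summing to $n$; $\ell(\beta)$ is its number of parts. For an integer sequence $a$, $\operatorname{fl}(a)$ is the sequence obtained by deleting all zero entries. Tunnel hook coverings (THCs) are combinatorial objects introduced by Allen and Mason; only the following facts about them are needed. For a composition $\beta=(\beta_1,\dots,\beta_\ell)$, every THC $T$ of shape $\beta$ has an associated permutation $\operatorname{perm}(T)\in S_\ell$, and $T\mapsto\operatorname{perm}(T)$ is a bijection from the set of THCs of shape $\beta$ onto $S_\ell$. Each THC $T$ of shape $\beta$ has an integer sequence $\Delta(T)=(\Delta_1(T),\dots,\Delta_\ell(T))$ with $\Delta_i(T)=\beta_i+\sigma_i-i$, where $\sigma=\operatorname{perm}(T)$ (in one-line notation $\sigma=[\sigma_1,\dots,\sigma_\ell]$). The content of $T$ is $\operatorname{fl}(\Delta(T))$. $\mathrm{THC}_{\alpha,\beta}$ denotes the set of THCs of shape $\beta$ and content $\alpha$. Dominance: $\alpha\trianglerighteq\beta$ means $\alpha_1+\dots+\alpha_i\geq\beta_1+\dots+\beta_i$ for all $i$ (padding with zeros). Lexicographic order: $\alpha\geq_\ell\beta$ means $\alpha=\beta$ or, for the smallest $i$ with $\alpha_i\neq\beta_i$,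 $\alpha_i>\beta_i$. -}

module Defs where

open import Data.Nat using (ℕ; zero; suc; _≤_; _<_)
open import Data.Integer as ℤ using (ℤ; +_; _-_)
open import Data.Fin using (Fin; toℕ)
open import Data.Fin.Permutation using (Permutation′; _⟨$⟩ʳ_)
open import Data.List using (List; []; _∷_; length; take; tabulate; filter; map)
open import Data.Nat.ListAction using (sum)
open import Relation.Nullary using (¬?)
open import Data.List.Relation.Unary.All using (All)
open import Data.Product using (Σ; _×_; ∃)
open import Data.Sum using (_⊎_)
open import Relation.Binary.PropositionalEquality using (_≡_)

IsComposition : ℕ → List ℕ → Set
IsComposition n a = All (λ x → 0 < x) a × sum a ≡ n

ℓ : List ℕ → ℕ
ℓ = length

fl : List ℤ → List ℤ
fl = filter (λ x → ¬? (x ℤ.≟ + 0))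

-- Tunnel hook coverings of shape β are identified with their permutations
-- via the bijection perm : THC(β) → S_ℓ(β); we therefore represent a THC of
-- shape β by perm(T) ∈ S_ℓ (a permutation of Fin ℓ).
THC : List ℕ → Set
THC β = Permutation′ (ℓ β)

perm : ∀ {β} → THC β → Permutation′ (ℓ β)
perm T = T

-- Δ_i(T) = β_i + σ_i − i  (0-based indices give the same differences)
Δ : (β : List ℕ) → THC β → List ℤ
Δ β T = tabulate (λ i → (+ Data.List.lookup β i ℤ.+ + toℕ (perm {β} T ⟨$⟩ʳ i)) - + toℕ i)

content : (β : List ℕ) → THC β → List ℤ
content β T = fl (Δ β T)

InTHC : (α β : List ℕ) → THC β → Set
InTHC α β T = content β T ≡ map +_ α

pad : List ℕ → ℕ → ℕ
pad []       _       = 0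
pad (x ∷ xs) zero    = x
pad (x ∷ xs) (suc i) = pad xs i

_⊵_ : List ℕ → List ℕ → Set
α ⊵ β = ∀ i → sum (take i β) ≤ sum (take i α)

_≥ₗ_ : List ℕ → List ℕ → Set
α ≥ₗ β = α ≡ β ⊎ ∃ λ i → (∀ j → j < i → pad α j ≡ pad β j) × pad β i < pad α i

IsIdentityPerm : ∀ {m} → Permutation′ m → Set
IsIdentityPerm {m} σ = ∀ (i : Fin m) → σ ⟨$⟩ʳ i ≡ i

{-# OPTIONS --safe #-}
-- Write σ = perm(T). If T has content α, every Δᵢ(T) = βᵢ + σᵢ − i is a natural number dᵢ
-- with fl(d) = α, so summing over the first i positions gives
--   (β₁ + ⋯ + βᵢ) + (σ₁ + ⋯ + σᵢ) = (d₁ + ⋯ + dᵢ) + (0 + 1 + ⋯ + (i − 1)).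
-- Deleting zeros only moves mass forward, so d₁ + ⋯ + dᵢ ≤ α₁ + ⋯ + αᵢ, while i distinct
-- naturals sum to at least 0 + 1 + ⋯ + (i − 1); hence α ⊵ β, and for compositions dominance
-- implies α ≥ₗ β. When α = β the same chain forces every prefix sum of σ to be minimal, which
-- pins σ down to the identity; and the identity does lie in THC_{α,α}, its Δ being α itself.
module Submission where

open import Defs
import Data.Integer.Properties as ℤP
import Data.Nat.Properties as ℕP
open import Algebra.Properties.CommutativeSemigroup ℕP.+-commutativeSemigroup using (interchange; x∙yz≈y∙xz)
open import Algebra.Properties.AbelianGroup ℤP.+-0-abelianGroup using (//-rightDividesˡ; //-rightDividesʳ)
open import Data.Fin using (Fin; toℕ; zero; suc)
open import Data.Fin.Permutation using (Permutation′; _⟨$⟩ʳ_; _⟨$⟩ˡ_)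
import Data.Fin.Permutation as Perm
open import Data.Fin.Properties using (toℕ<n; toℕ-injective)
open import Data.Integer as ℤ using (∣_∣)
open import Data.List using (List; []; _∷_; [_]; _++_; length; take; tabulate; filter; map; lookup; upTo; applyUpTo)
open import Data.List.Membership.Propositional using (_∈_)
open import Data.List.Membership.DecPropositional ℕP._≟_ using (_∈?_)
open import Data.List.Membership.Propositional.Properties using (∈-filter⁺; ∈-map⁻)
open import Data.List.Properties
  using (filter-all; length-removeAt′; length-take; length-tabulate; map-injective; map-tabulate;
         map-upTo; take-map; take-suc-tabulate; tabulate-cong; tabulate-lookup; upTo-∷ʳ)
open import Data.List.Relation.Unary.All as All using (All; _∷_)
import Data.List.Relation.Unary.All.Properties as AllP
open import Data.List.Relation.Unary.Any using (here; there; _─_; index)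
open import Data.List.Relation.Unary.Unique.Propositional using (Unique; _∷_)
import Data.List.Relation.Unary.Unique.Propositional.Properties as UniqueP
open import Data.Nat using (ℕ; zero; suc; _+_; _⊓_; _≤_; _<_; z≤n; s≤s; s≤s⁻¹)
open import Data.Nat.ListAction using (sum)
open import Data.Nat.ListAction.Properties using (sum-++)
open import Data.Product using (_×_; ∃; _,_)
open import Data.Sum using (inj₁; inj₂)
open import Function using (_∘_)
open import Function.Definitions using (Injective)
open import Relation.Nullary using (¬?; yes; no; contradiction)
open import Relation.Binary.PropositionalEquality
  using (_≡_; _≢_; refl; sym; trans; cong; subst; ≢-sym; module ≡-Reasoning)

dropZeros : List ℕ → List ℕ
dropZeros = filter (λ x → ¬? (x ℕP.≟ 0))

fl-map-+ : ∀ ds → fl (map ℤ.+_ ds) ≡ map ℤ.+_ (dropZeros ds)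
fl-map-+ []           = refl
fl-map-+ (zero  ∷ ds) = fl-map-+ ds
fl-map-+ (suc d ∷ ds) = cong (ℤ.+ suc d ∷_) (fl-map-+ ds)

fl≡map-+⇒nonNegative : ∀ {xs α} → fl xs ≡ map ℤ.+_ α → All (λ x → ℤ.+ ∣ x ∣ ≡ x) xs
fl≡map-+⇒nonNegative {xs} fl≡α = All.tabulate nonNegative
  where
  nonNegative : ∀ {x} → x ∈ xs → ℤ.+ ∣ x ∣ ≡ x
  nonNegative {x} x∈xs with x ℤ.≟ ℤ.0ℤ
  ... | yes refl = refl
  ... | no  x≢0  with x∈fl-xs ← ∈-filter⁺ (λ y → ¬? (y ℤ.≟ ℤ.0ℤ)) x∈xs x≢0
                 with ∈-map⁻ ℤ.+_ (subst (x ∈_) fl≡α x∈fl-xs)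
  ...   | _ , _ , refl = refl

sum-take≤sum-take-suc : ∀ i (xs : List ℕ) → sum (take i xs) ≤ sum (take (suc i) xs)
sum-take≤sum-take-suc zero    xs       = z≤n
sum-take≤sum-take-suc (suc i) []       = z≤n
sum-take≤sum-take-suc (suc i) (x ∷ xs) = ℕP.+-monoʳ-≤ x (sum-take≤sum-take-suc i xs)

sum-take≤sum-take-dropZeros : ∀ i xs → sum (take i xs) ≤ sum (take i (dropZeros xs))
sum-take≤sum-take-dropZeros zero    xs           = z≤n
sum-take≤sum-take-dropZeros (suc i) []           = z≤n
sum-take≤sum-take-dropZeros (suc i) (zero  ∷ xs) =
  ℕP.≤-trans (sum-take≤sum-take-dropZeros i xs) (sum-take≤sum-take-suc i (dropZeros xs))
sum-take≤sum-take-dropZeros (suc i) (suc x ∷ xs) =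
  ℕP.+-monoʳ-≤ (suc x) (sum-take≤sum-take-dropZeros i xs)

⊵⇒≥ₗ : ∀ {α β} → All (0 <_) α → All (0 <_) β → α ⊵ β → α ≥ₗ β
⊵⇒≥ₗ {[]}    {[]}    _           _           _   = inj₁ refl
⊵⇒≥ₗ {[]}    {b ∷ β} _           (0<b ∷ _)   α⊵β =
  contradiction (α⊵β 1) (ℕP.<⇒≱ (ℕP.<-≤-trans 0<b (ℕP.m≤m+n b 0)))
⊵⇒≥ₗ {a ∷ α} {[]}    (0<a ∷ _)   _           _   = inj₂ (0 , (λ _ ()) , 0<a)
⊵⇒≥ₗ {a ∷ α} {b ∷ β} (_ ∷ α>0)   (_ ∷ β>0)   α⊵β with ℕP.m≤n⇒m<n∨m≡n (ℕP.+-cancelʳ-≤ 0 b a (α⊵β 1))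
... | inj₁ b<a  = inj₂ (0 , (λ _ ()) , b<a)
... | inj₂ refl with ⊵⇒≥ₗ α>0 β>0 (λ i → ℕP.+-cancelˡ-≤ b _ _ (α⊵β (suc i)))
...   | inj₁ refl               = inj₁ refl
...   | inj₂ (i , agree , α>β) = inj₂ (suc i , agree′ , α>β)
  where
  agree′ : ∀ j → j < suc i → pad (b ∷ α) j ≡ pad (b ∷ β) j
  agree′ zero    _       = refl
  agree′ (suc j) 1+j<1+i = agree j (s≤s⁻¹ 1+j<1+i)

sum-─ : ∀ {x xs} (x∈xs : x ∈ xs) → sum xs ≡ x + sum (xs ─ x∈xs)
sum-─ (here refl)                = refl
sum-─ {x} {y ∷ xs} (there x∈xs) = trans (cong (y +_) (sum-─ x∈xs)) (x∙yz≈y∙xz y x _)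

Unique-─ : ∀ {x} {xs : List ℕ} → Unique xs → (x∈xs : x ∈ xs) → Unique (xs ─ x∈xs)
Unique-─ (_   ∷ xs!) (here refl)  = xs!
Unique-─ (y∉ ∷ xs!) (there x∈xs) = AllP.─⁺ x∈xs y∉ ∷ Unique-─ xs! x∈xs

Unique⇒∉-─ : ∀ {x} {xs : List ℕ} → Unique xs → (x∈xs : x ∈ xs) → All (x ≢_) (xs ─ x∈xs)
Unique⇒∉-─ (x∉ ∷ _)   (here refl)  = x∉
Unique⇒∉-─ (y∉ ∷ xs!) (there x∈xs) = ≢-sym (All.lookup y∉ x∈xs) ∷ Unique⇒∉-─ xs! x∈xs

All<1+n⇒All<n : ∀ {n xs} → All (_< suc n) xs → All (n ≢_) xs → All (_< n) xs
All<1+n⇒All<n xs<1+n n≢xs =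
  All.zipWith (λ (x<1+n , n≢x) → ℕP.≤∧≢⇒< (s≤s⁻¹ x<1+n) (≢-sym n≢x)) (xs<1+n , n≢xs)

Unique-─-bound : ∀ {n xs} → Unique xs → All (_< suc n) xs → (n∈xs : n ∈ xs) →
  Unique (xs ─ n∈xs) × All (_< n) (xs ─ n∈xs)
Unique-─-bound xs! xs<1+n n∈xs =
  Unique-─ xs! n∈xs , All<1+n⇒All<n (AllP.─⁺ n∈xs xs<1+n) (Unique⇒∉-─ xs! n∈xs)

length≤bound : ∀ n {xs} → Unique xs → All (_< n) xs → length xs ≤ n
length≤bound zero    {[]}    _   _        = z≤n
length≤bound zero    {_ ∷ _} _   (() ∷ _)
length≤bound (suc n) {xs}    xs! xs<1+n with n ∈? xs
... | no  n∉xs = ℕP.m≤n⇒m≤1+n (length≤bound n xs! (All<1+n⇒All<n xs<1+n (AllP.¬Any⇒All¬ xs n∉xs)))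
... | yes n∈xs with Unique-─-bound xs! xs<1+n n∈xs
...   | ys! , ys<n = begin
  length xs                 ≡⟨ length-removeAt′ xs (index n∈xs) ⟩
  suc (length (xs ─ n∈xs))  ≤⟨ s≤s (length≤bound n ys! ys<n) ⟩
  suc n                     ∎
  where open ℕP.≤-Reasoning

sum-upTo-suc : ∀ k → sum (upTo (suc k)) ≡ sum (upTo k) + k
sum-upTo-suc k = begin
  sum (upTo (suc k))        ≡⟨ cong sum (upTo-∷ʳ k) ⟨
  sum (upTo k ++ [ k ])     ≡⟨ sum-++ (upTo k) [ k ] ⟩
  sum (upTo k) + (k + 0)    ≡⟨ cong (sum (upTo k) +_) (ℕP.+-identityʳ k) ⟩
  sum (upTo k) + k          ∎
  where open ≡-Reasoning

sum-upTo-length≤sum : ∀ n {xs} → Unique xs → All (_< n) xs → sum (upTo (length xs)) ≤ sum xs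
sum-upTo-length≤sum zero    {[]}    _   _        = z≤n
sum-upTo-length≤sum zero    {_ ∷ _} _   (() ∷ _)
sum-upTo-length≤sum (suc n) {xs}    xs! xs<1+n with n ∈? xs
... | no  n∉xs = sum-upTo-length≤sum n xs! (All<1+n⇒All<n xs<1+n (AllP.¬Any⇒All¬ xs n∉xs))
... | yes n∈xs with Unique-─-bound xs! xs<1+n n∈xs
...   | ys! , ys<n = begin
  sum (upTo (length xs))               ≡⟨ cong (sum ∘ upTo) (length-removeAt′ xs (index n∈xs)) ⟩
  sum (upTo (suc (length ys)))         ≡⟨ sum-upTo-suc (length ys) ⟩
  sum (upTo (length ys)) + length ys   ≤⟨ ℕP.+-mono-≤ (sum-upTo-length≤sum n ys! ys<n) (length≤bound n ys! ys<n) ⟩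
  sum ys + n                           ≡⟨ ℕP.+-comm (sum ys) n ⟩
  n + sum ys                           ≡⟨ sum-─ n∈xs ⟨
  sum xs                               ∎
  where
  open ℕP.≤-Reasoning
  ys : List ℕ
  ys = xs ─ n∈xs

prefixSum : ∀ {m} → (Fin m → ℕ) → ℕ → ℕ
prefixSum f i = sum (take i (tabulate f))

prefixSum-+ : ∀ {m} (f g : Fin m → ℕ) i → prefixSum (λ j → f j + g j) i ≡ prefixSum f i + prefixSum g i
prefixSum-+         f g zero    = refl
prefixSum-+ {zero}  f g (suc i) = refl
prefixSum-+ {suc m} f g (suc i) =
  trans (cong (f zero + g zero +_) (prefixSum-+ (f ∘ suc) (g ∘ suc) i)) (interchange (f zero) (g zero) _ _)

prefixSum-suc : ∀ {m} (f : Fin m → ℕ) j → prefixSum f (suc (toℕ j)) ≡ prefixSum f (toℕ j) + f j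
prefixSum-suc f j = begin
  sum (take (suc (toℕ j)) (tabulate f))           ≡⟨ cong sum (take-suc-tabulate f j) ⟩
  sum (take (toℕ j) (tabulate f) ++ [ f j ])      ≡⟨ sum-++ (take (toℕ j) (tabulate f)) [ f j ] ⟩
  prefixSum f (toℕ j) + (f j + 0)                 ≡⟨ cong (prefixSum f (toℕ j) +_) (ℕP.+-identityʳ (f j)) ⟩
  prefixSum f (toℕ j) + f j                       ∎
  where open ≡-Reasoning

prefixSum-injective : ∀ {m} {f g : Fin m → ℕ} → (∀ i → prefixSum f i ≡ prefixSum g i) → ∀ j → f j ≡ g j
prefixSum-injective {f = f} {g} f≡g j = ℕP.+-cancelˡ-≡ (prefixSum g (toℕ j)) (f j) (g j) (begin
  prefixSum g (toℕ j) + f j    ≡⟨ cong (_+ f j) (f≡g (toℕ j)) ⟨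
  prefixSum f (toℕ j) + f j    ≡⟨ prefixSum-suc f j ⟨
  prefixSum f (suc (toℕ j))    ≡⟨ f≡g (suc (toℕ j)) ⟩
  prefixSum g (suc (toℕ j))    ≡⟨ prefixSum-suc g j ⟩
  prefixSum g (toℕ j) + g j    ∎)
  where open ≡-Reasoning

take-tabulate-toℕ : ∀ {m} i → take i (tabulate (toℕ {m})) ≡ upTo (i ⊓ m)
take-tabulate-toℕ         zero    = refl
take-tabulate-toℕ {zero}  (suc i) = refl
take-tabulate-toℕ {suc m} (suc i) = cong (0 ∷_) (begin
  take i (tabulate (suc ∘ toℕ))     ≡⟨ cong (take i) (map-tabulate toℕ suc) ⟨
  take i (map suc (tabulate toℕ))   ≡⟨ take-map i (tabulate toℕ) ⟩
  map suc (take i (tabulate toℕ))   ≡⟨ cong (map suc) (take-tabulate-toℕ i) ⟩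
  map suc (upTo (i ⊓ m))            ≡⟨ map-upTo suc (i ⊓ m) ⟩
  applyUpTo suc (i ⊓ m)             ∎)
  where open ≡-Reasoning

prefixSum-toℕ≤prefixSum-injective : ∀ {m n} (f : Fin m → Fin n) → Injective _≡_ _≡_ f →
  ∀ i → prefixSum toℕ i ≤ prefixSum (toℕ ∘ f) i
prefixSum-toℕ≤prefixSum-injective {m} {n} f f-injective i = begin
  prefixSum toℕ i            ≡⟨ cong sum (take-tabulate-toℕ i) ⟩
  sum (upTo (i ⊓ m))         ≡⟨ cong (sum ∘ upTo) length-xs ⟨
  sum (upTo (length xs))     ≤⟨ sum-upTo-length≤sum n xs! xs<n ⟩
  sum xs                     ∎
  where
  open ℕP.≤-Reasoning
  xs : List ℕ
  xs = take i (tabulate (toℕ ∘ f))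
  length-xs : length xs ≡ i ⊓ m
  length-xs = trans (length-take i _) (cong (i ⊓_) (length-tabulate (toℕ ∘ f)))
  xs! : Unique xs
  xs! = UniqueP.take⁺ i (UniqueP.tabulate⁺ (f-injective ∘ toℕ-injective))
  xs<n : All (_< n) xs
  xs<n = AllP.take⁺ i (AllP.tabulate⁺ (toℕ<n ∘ f))

perm-injective : ∀ {m} (σ : Permutation′ m) → Injective _≡_ _≡_ (σ ⟨$⟩ʳ_)
perm-injective σ {i} {j} σi≡σj = begin
  i                        ≡⟨ Perm.inverseˡ σ ⟨
  σ ⟨$⟩ˡ (σ ⟨$⟩ʳ i)        ≡⟨ cong (σ ⟨$⟩ˡ_) σi≡σj ⟩
  σ ⟨$⟩ˡ (σ ⟨$⟩ʳ j)        ≡⟨ Perm.inverseˡ σ ⟩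
  j                        ∎
  where open ≡-Reasoning

InTHC⇒balanced : ∀ α β (σ : THC β) → InTHC α β σ →
  ∃ λ (d : Fin (ℓ β) → ℕ) →
    (∀ j → lookup β j + toℕ (σ ⟨$⟩ʳ j) ≡ d j + toℕ j) × α ≡ dropZeros (tabulate d)
InTHC⇒balanced α β σ T∈ = d , balanced , α≡
  where
  -- Δ β σ is definitionally tabulate δ.
  δ : Fin (ℓ β) → ℤ.ℤ
  δ j = (ℤ.+ lookup β j ℤ.+ ℤ.+ toℕ (σ ⟨$⟩ʳ j)) ℤ.- ℤ.+ toℕ j
  d : Fin (ℓ β) → ℕ
  d j = ∣ δ j ∣
  d≡δ : ∀ j → ℤ.+ d j ≡ δ j
  d≡δ = AllP.tabulate⁻ (fl≡map-+⇒nonNegative T∈)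
  balanced : ∀ j → lookup β j + toℕ (σ ⟨$⟩ʳ j) ≡ d j + toℕ j
  balanced j = ℤP.+-injective (sym (trans (cong (ℤ._+ ℤ.+ toℕ j) (d≡δ j))
                                          (//-rightDividesˡ (ℤ.+ toℕ j) _)))
  α≡ : α ≡ dropZeros (tabulate d)
  α≡ = map-injective ℤP.+-injective (begin
    map ℤ.+_ α                         ≡⟨ T∈ ⟨
    fl (tabulate δ)                    ≡⟨ cong fl (tabulate-cong (sym ∘ d≡δ)) ⟩
    fl (tabulate (ℤ.+_ ∘ d))           ≡⟨ cong fl (map-tabulate d (ℤ.+_)) ⟨
    fl (map ℤ.+_ (tabulate d))         ≡⟨ fl-map-+ (tabulate d) ⟩
    map ℤ.+_ (dropZeros (tabulate d))  ∎)
    where open ≡-Reasoning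

InTHC⇒shape+perm≤content+id : ∀ α β (σ : THC β) → InTHC α β σ →
  ∀ i → sum (take i β) + prefixSum (toℕ ∘ (σ ⟨$⟩ʳ_)) i ≤ sum (take i α) + prefixSum toℕ i
InTHC⇒shape+perm≤content+id α β σ T∈ i with InTHC⇒balanced α β σ T∈
... | d , balanced , α≡ = begin
  sum (take i β) + prefixSum s i
    ≡⟨ cong (λ xs → sum (take i xs) + prefixSum s i) (tabulate-lookup β) ⟨
  prefixSum (lookup β) i + prefixSum s i
    ≡⟨ prefixSum-+ (lookup β) s i ⟨
  prefixSum (λ j → lookup β j + s j) i
    ≡⟨ cong (sum ∘ take i) (tabulate-cong balanced) ⟩
  prefixSum (λ j → d j + toℕ j) i
    ≡⟨ prefixSum-+ d toℕ i ⟩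
  prefixSum d i + prefixSum toℕ i
    ≤⟨ ℕP.+-monoˡ-≤ (prefixSum toℕ i) (sum-take≤sum-take-dropZeros i (tabulate d)) ⟩
  sum (take i (dropZeros (tabulate d))) + prefixSum toℕ i
    ≡⟨ cong (λ xs → sum (take i xs) + prefixSum toℕ i) α≡ ⟨
  sum (take i α) + prefixSum toℕ i
    ∎
  where
  open ℕP.≤-Reasoning
  s : Fin (ℓ β) → ℕ
  s = toℕ ∘ (σ ⟨$⟩ʳ_)

InTHC⇒⊵ : ∀ α β (σ : THC β) → InTHC α β σ → α ⊵ β
InTHC⇒⊵ α β σ T∈ i = ℕP.+-cancelʳ-≤ (prefixSum toℕ i) _ _ (ℕP.≤-trans
  (ℕP.+-monoʳ-≤ (sum (take i β)) (prefixSum-toℕ≤prefixSum-injective (σ ⟨$⟩ʳ_) (perm-injective σ) i))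
  (InTHC⇒shape+perm≤content+id α β σ T∈ i))

InTHC-diagonal⇒identity : ∀ α (σ : THC α) → InTHC α α σ → IsIdentityPerm σ
InTHC-diagonal⇒identity α σ T∈ j = toℕ-injective (prefixSum-injective prefixSums-agree j)
  where
  prefixSums-agree : ∀ i → prefixSum (toℕ ∘ (σ ⟨$⟩ʳ_)) i ≡ prefixSum toℕ i
  prefixSums-agree i = ℕP.≤-antisym
    (ℕP.+-cancelˡ-≤ (sum (take i α)) _ _ (InTHC⇒shape+perm≤content+id α α σ T∈ i))
    (prefixSum-toℕ≤prefixSum-injective (σ ⟨$⟩ʳ_) (perm-injective σ) i)

identity-InTHC : ∀ {α} → All (0 <_) α → InTHC α α Perm.id
identity-InTHC {α} α>0 = begin
  fl (tabulate (λ i → (ℤ.+ lookup α i ℤ.+ ℤ.+ toℕ i) ℤ.- ℤ.+ toℕ i))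
    ≡⟨ cong fl (tabulate-cong (λ i → //-rightDividesʳ (ℤ.+ toℕ i) (ℤ.+ lookup α i))) ⟩
  fl (tabulate (ℤ.+_ ∘ lookup α))
    ≡⟨ cong fl (map-tabulate (lookup α) (ℤ.+_)) ⟨
  fl (map ℤ.+_ (tabulate (lookup α)))
    ≡⟨ cong (fl ∘ map (ℤ.+_)) (tabulate-lookup α) ⟩
  fl (map ℤ.+_ α)
    ≡⟨ fl-map-+ α ⟩
  map ℤ.+_ (dropZeros α)
    ≡⟨ cong (map (ℤ.+_)) (filter-all (λ x → ¬? (x ℕP.≟ 0)) (All.map ℕP.>⇒≢ α>0)) ⟩
  map ℤ.+_ α
    ∎
  where open ≡-Reasoning

lemma2p6 : (n : ℕ) → 0 < n → (α β : List ℕ) → IsComposition n α → IsComposition n β →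
    ((∃ λ (T : THC β) → InTHC α β T) → (α ⊵ β) × (α ≥ₗ β))
    × (∃ λ (T : THC α) → InTHC α α T × IsIdentityPerm (perm {α} T)
         × (∀ (T′ : THC α) → InTHC α α T′ → ∀ i → perm {α} T′ ⟨$⟩ʳ i ≡ perm {α} T ⟨$⟩ʳ i))
lemma2p6 _ _ α β (α>0 , _) (β>0 , _) =
  (λ (σ , T∈) → let α⊵β = InTHC⇒⊵ α β σ T∈ in α⊵β , ⊵⇒≥ₗ α>0 β>0 α⊵β) ,
  (Perm.id , identity-InTHC α>0 , (λ _ → refl) , InTHC-diagonal⇒identity α)
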